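{- Let $m>n\ge1$ be coprime, $\lambda\in X$, $\Lambda=x(\lambda)$ and $\alpha=\epsilon_i-\delta_j$. If $\Lambda\in\Pi_\alpha$, then $\lambda\in X_\alpha$ unless $(m,1^{n-1})\subseteq\lambda$ and $\alpha=\epsilon_n-\delta_1$.
   Context: $X$: partitions $\lambda=(\lambda_1\ge\dots\ge\lambda_n\ge0)$ with $\lambda_1\le m$, drawn in the grid with rows $\epsilon_1,\dots,\epsilon_n$ (top to bottom) and columns $\delta_1,\dots,\delta_m$, with $\lambda_k$ left-justified boxes in row $\epsilon_{n+1-k}$; $\lambda'_j=|\{k:\lambda_k\ge j\}|$; containment of partitions is containment of diagrams. $X_\alpha$: those $\lambda$ for which box $\epsilon_i-\delta_j$ (row $\epsilon_i$, column $\delta_j$) is an outer corner (not in $\lambda$, and adding it gives a Young diagram). $x(\lambda)=(a_1,\dots,a_n|b_1,\dots,b_m)\in\mathbb Z^{n|m}$ with $a_i=m(n-i)+n\lambda_{n+1-i}$, $b_j=n(j-1)+m\lambda'_j$. $\Pi_\alpha$ is the set of $(a|b)$ with $a_i-b_j=0$. -}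

module Defs where

open import Data.Nat using (ℕ; zero; suc; _+_; _*_; _∸_; _≤_; _<_; _≤?_)
open import Data.Fin using (Fin; toℕ; opposite)
open import Data.List using (length; filter; allFin)
open import Data.Product using (_×_)
open import Relation.Binary.PropositionalEquality using (_≡_)

-- A sequence λ = (λ₁,…,λₙ) is encoded as  lam : Fin n → ℕ  with
-- lam k = λ_{toℕ k + 1}  (0-based partition index).

InX : (m n : ℕ) → (Fin n → ℕ) → Set
InX m n lam =
  (∀ (k l : Fin n) → toℕ k ≤ toℕ l → lam l ≤ lam k) × (∀ (k : Fin n) → lam k ≤ m)

conj : ∀ {n} → (Fin n → ℕ) → ℕ → ℕ
conj {n} lam j = length (filter (λ k → j ≤? lam k) (allFin n))

-- Row ε_i (i : Fin n, i.e. row number toℕ i + 1) carries λ_{n+1-i} boxes,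
-- whose 0-based partition index is  opposite i.
-- a_i = m(n-i) + n λ_{n+1-i}
aCoord : (m n : ℕ) → (Fin n → ℕ) → Fin n → ℕ
aCoord m n lam i = m * (n ∸ suc (toℕ i)) + n * lam (opposite i)

-- b_j = n(j-1) + m λ'_j   (j : Fin m, column number toℕ j + 1)
bCoord : (m n : ℕ) → (Fin n → ℕ) → Fin m → ℕ
bCoord m n lam j = n * toℕ j + m * conj lam (suc (toℕ j))

InPi : (m n : ℕ) → (Fin n → ℕ) → Fin n → Fin m → Set
InPi m n lam i j = aCoord m n lam i ≡ bCoord m n lam j

-- Box in partition row k (0-based index) and column c+1 (c = toℕ j) is an
-- outer corner of λ: not in λ and adding it gives a Young diagram, i.e.
-- λ_k = c (box is immediately right of row k) and every longer-index-earlier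
-- part λ_{k'} (k' before k) is ≥ c+1.
OuterCornerAt : ∀ {n} → (Fin n → ℕ) → Fin n → ℕ → Set
OuterCornerAt {n} lam k c = (lam k ≡ c) × (∀ (k' : Fin n) → toℕ k' < toℕ k → suc c ≤ lam k')

-- λ ∈ X_α, α = ε_i - δ_j : box (row ε_i, column δ_j) is an outer corner
InXα : (m n : ℕ) → (Fin n → ℕ) → Fin n → Fin m → Set
InXα m n lam i j = OuterCornerAt lam (opposite i) (toℕ j)

hook : (m n : ℕ) → Fin n → ℕ
hook m n k with toℕ k
... | zero = m
... | suc _ = 1

_⊆ₚ_ : ∀ {n} → (Fin n → ℕ) → (Fin n → ℕ) → Set
_⊆ₚ_ {n} μ lam = ∀ (k : Fin n) → μ k ≤ lam k

-- Put k = n - i (the 0-based partition index of row ε_i), c = j - 1, L = λ_k and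
-- q = λ'_{c+1}. Then a_i = b_j reads m(k - q) = n(c - L), so by coprimality
-- n divides k - q, which lies strictly between -n and n unless k = 0 and
-- q = n. In the generic case k = q and L = c, which says precisely that the
-- box (k, c+1) is an outer corner. In the exceptional case L = c + m ≤ m
-- forces c = 0 and L = m, while q = λ'_1 = n: this is (m, 1^{n-1}) ⊆ λ with
-- α = ε_n - δ_1.
module Submission where

open import Defs
open import Data.Nat using (ℕ; _≤_; _<_)
open import Data.Nat.Coprimality using (Coprime)
open import Data.Fin using (Fin; toℕ)
open import Data.Product using (_×_)
open import Relation.Binary.PropositionalEquality using (_≡_)
open import Relation.Nullary using (¬_)
open import Data.Nat using (_∸_)

open import Data.Nat using (zero; suc; _+_; _*_; z≤n; s≤s; _≤?_; NonZero; >-nonZero)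
open import Data.Nat.Properties
open import Data.Nat.Divisibility using (_∣_; ∣m+n∣m⇒∣n; m∣m*n; ∣⇒≤)
import Data.Nat.Coprimality as Coprimality
open import Data.Fin using (zero; suc; opposite)
open import Data.Fin.Properties using (opposite-prop; opposite-involutive; toℕ-injective; toℕ<n)
open import Data.List using (length; filter; tabulate; allFin)
open import Data.List.Properties using (length-filter; length-tabulate)
open import Data.Product using (_,_)
open import Data.Sum using (_⊎_; inj₁; inj₂)
open import Data.Empty using (⊥-elim)
open import Relation.Binary.PropositionalEquality using (refl; sym; trans; cong; subst; module ≡-Reasoning)
open import Relation.Nullary using (yes; no)
open import Relation.Unary using (Pred; Decidable)
open import Data.Nat.Solver using (module +-*-Solver)
open +-*-Solver using (solve; _:+_; _:*_; _:=_)

length-filter-tabulate-≤ : ∀ {a p} {A : Set a} {P : Pred A p} (P? : Decidable P)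
  {n} (f : Fin n → A) (k : ℕ) → (∀ (k' : Fin n) → k ≤ toℕ k' → ¬ P (f k')) →
  length (filter P? (tabulate f)) ≤ k
length-filter-tabulate-≤ P? {zero} f k none = z≤n
length-filter-tabulate-≤ P? {suc n} f zero none with P? (f zero)
... | yes p = ⊥-elim (none zero z≤n p)
... | no _ = length-filter-tabulate-≤ P? (λ x → f (suc x)) zero (λ k' _ → none (suc k') z≤n)
length-filter-tabulate-≤ P? {suc n} f (suc k) none with P? (f zero)
... | yes _ = s≤s (length-filter-tabulate-≤ P? (λ x → f (suc x)) k (λ k' le → none (suc k') (s≤s le)))
... | no _ = m≤n⇒m≤1+n (length-filter-tabulate-≤ P? (λ x → f (suc x)) k (λ k' le → none (suc k') (s≤s le)))

Antitone : ∀ {n} → (Fin n → ℕ) → Set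
Antitone {n} lam = ∀ (k l : Fin n) → toℕ k ≤ toℕ l → lam l ≤ lam k

conj≤n : ∀ {n} (lam : Fin n → ℕ) (t : ℕ) → conj lam t ≤ n
conj≤n {n} lam t =
  ≤-trans (length-filter (λ k → t ≤? lam k) (allFin n)) (≤-reflexive (length-tabulate (λ k → k)))

module _ {n : ℕ} {lam : Fin n → ℕ} (antitone : Antitone lam) {t : ℕ} where

  conj≤toℕ : (k : Fin n) → lam k < t → conj lam t ≤ toℕ k
  conj≤toℕ k lamk<t = length-filter-tabulate-≤ (λ k → t ≤? lam k) (λ x → x) (toℕ k)
    (λ k' k≤k' t≤lamk' → <⇒≱ lamk<t (≤-trans t≤lamk' (antitone k k' k≤k')))

  <conj⇒≤ : (k : Fin n) → toℕ k < conj lam t → t ≤ lam k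
  <conj⇒≤ k k<conj with t ≤? lam k
  ... | yes t≤lamk = t≤lamk
  ... | no t≰lamk = ⊥-elim (<⇒≱ k<conj (conj≤toℕ k (≰⇒> t≰lamk)))

outerCornerAt-conj : ∀ {n} {lam : Fin n → ℕ} → Antitone lam → (k : Fin n) (c : ℕ) →
  lam k ≡ c → conj lam (suc c) ≡ toℕ k → OuterCornerAt lam k c
outerCornerAt-conj antitone k c lamk≡c conj≡k =
  lamk≡c , λ k' k'<k → <conj⇒≤ antitone k' (subst (toℕ k' <_) (sym conj≡k) k'<k)

hook-⊆ₚ : ∀ {m n} {lam : Fin n → ℕ} (k₀ : Fin n) → toℕ k₀ ≡ 0 → m ≤ lam k₀ →
  (∀ k → 1 ≤ lam k) → hook m n ⊆ₚ lam
hook-⊆ₚ {lam = lam} k₀ k₀≡0 m≤lamk₀ rows k with toℕ k in k≡0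
... | zero = subst (λ x → _ ≤ lam x) (toℕ-injective (trans k₀≡0 (sym k≡0))) m≤lamk₀
... | suc _ = rows k

toℕ-opposite≡0 : ∀ {n} (i : Fin n) → toℕ (opposite i) ≡ 0 → toℕ i ≡ n ∸ 1
toℕ-opposite≡0 {n} i opp≡0 = begin
  toℕ i                           ≡⟨ cong toℕ (sym (opposite-involutive i)) ⟩
  toℕ (opposite (opposite i))     ≡⟨ opposite-prop (opposite i) ⟩
  n ∸ suc (toℕ (opposite i))      ≡⟨ cong (λ d → n ∸ suc d) opp≡0 ⟩
  n ∸ 1                           ∎
  where open ≡-Reasoning

coprime-∣-cancel : ∀ {n m x y e} → Coprime n m → n * x ≡ n * y + m * e → n ∣ e
coprime-∣-cancel {n} {m} {x} {y} cop eq =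
  Coprimality.coprime-divisor cop (∣m+n∣m⇒∣n (subst (n ∣_) eq (m∣m*n x)) (m∣m*n y))

∣∧≤⇒≡0⊎≡ : ∀ {n e} → n ∣ e → e ≤ n → e ≡ 0 ⊎ e ≡ n
∣∧≤⇒≡0⊎≡ {e = zero} _ _ = inj₁ refl
∣∧≤⇒≡0⊎≡ {e = suc _} n∣e e≤n = inj₂ (≤-antisym e≤n (∣⇒≤ n∣e))

module _ {m n : ℕ} .{{_ : NonZero n}} (cop : Coprime n m) {d q L c : ℕ}
         (d<n : d < n) (q≤n : q ≤ n) (balance : m * d + n * L ≡ n * c + m * q) where

  private
    raised : ∀ e → d + e ≡ q → (d ≡ q × L ≡ c) ⊎ (d ≡ 0 × q ≡ n × L ≡ c + m)
    raised e refl = by-cases (∣∧≤⇒≡0⊎≡ (coprime-∣-cancel cop nL≡nc+me) (m+n≤o⇒n≤o d q≤n))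
      where
      nL≡nc+me : n * L ≡ n * c + m * e
      nL≡nc+me = +-cancelˡ-≡ (m * d) _ _ (trans balance
        (solve 5 (λ M D N C E → N :* C :+ M :* (D :+ E) := M :* D :+ (N :* C :+ M :* E)) refl m d n c e))

      by-cases : e ≡ 0 ⊎ e ≡ n → (d ≡ q × L ≡ c) ⊎ (d ≡ 0 × q ≡ n × L ≡ c + m)
      by-cases (inj₁ refl) = inj₁ (sym (+-identityʳ d) ,
        *-cancelˡ-≡ L c n (trans nL≡nc+me (trans (cong (n * c +_) (*-zeroʳ m)) (+-identityʳ (n * c)))))
      by-cases (inj₂ refl) = inj₂ (d≡0 , cong (_+ n) d≡0 ,
        *-cancelˡ-≡ L (c + m) n (trans nL≡nc+me (solve 3 (λ M N C → N :* C :+ M :* N := N :* (C :+ M)) refl m n c)))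
        where
        d≡0 : d ≡ 0
        d≡0 = n≤0⇒n≡0 (+-cancelʳ-≤ n d 0 q≤n)

    lowered : ∀ e → q + e ≡ d → d ≡ q × L ≡ c
    lowered e refl = by-cases (∣∧≤⇒≡0⊎≡ (coprime-∣-cancel cop nc≡nL+me) (≤-trans (m≤n+m e q) (<⇒≤ d<n)))
      where
      nc≡nL+me : n * c ≡ n * L + m * e
      nc≡nL+me = +-cancelˡ-≡ (m * q) _ _ (trans (+-comm (m * q) (n * c)) (trans (sym balance)
        (solve 5 (λ M Q N L E → M :* (Q :+ E) :+ N :* L := M :* Q :+ (N :* L :+ M :* E)) refl m q n L e)))

      by-cases : e ≡ 0 ⊎ e ≡ n → d ≡ q × L ≡ c
      by-cases (inj₁ refl) = +-identityʳ q ,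
        *-cancelˡ-≡ L c n (sym (trans nc≡nL+me (trans (cong (n * L +_) (*-zeroʳ m)) (+-identityʳ (n * L)))))
      by-cases (inj₂ refl) = ⊥-elim (<⇒≱ d<n (m≤n+m n q))

  coprime-balance : (d ≡ q × L ≡ c) ⊎ (d ≡ 0 × q ≡ n × L ≡ c + m)
  coprime-balance with ≤-total d q
  ... | inj₁ d≤q = let e , d+e≡q = m≤n⇒∃[o]m+o≡n d≤q in raised e d+e≡q
  ... | inj₂ q≤d = let e , q+e≡d = m≤n⇒∃[o]m+o≡n q≤d in inj₁ (lowered e q+e≡d)
lemma4p5 : (m n : ℕ) → 1 ≤ n → n < m → Coprime m n →
    (lam : Fin n → ℕ) → InX m n lam →
    (i : Fin n) (j : Fin m) → InPi m n lam i j →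
    ¬ ((hook m n ⊆ₚ lam) × (toℕ i ≡ n ∸ 1) × (toℕ j ≡ 0)) →
    InXα m n lam i j
lemma4p5 m n 1≤n _ cop lam (antitone , bounded) i j x∈Π notException =
  conclude (coprime-balance {{>-nonZero 1≤n}} (Coprimality.sym cop) (toℕ<n k) (conj≤n lam (suc c)) balance)
  where
  k = opposite i
  c = toℕ j
  q = conj lam (suc c)

  balance : m * toℕ k + n * lam k ≡ n * c + m * q
  balance = subst (λ d → m * d + n * lam k ≡ n * c + m * q) (sym (opposite-prop i)) x∈Π

  conclude : (toℕ k ≡ q × lam k ≡ c) ⊎ (toℕ k ≡ 0 × q ≡ n × lam k ≡ c + m) → InXα m n lam i j
  conclude (inj₁ (k≡q , lamk≡c)) = outerCornerAt-conj antitone k c lamk≡c (sym k≡q)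
  conclude (inj₂ (k≡0 , q≡n , lamk≡c+m)) =
    ⊥-elim (notException (hook-⊆ₚ k k≡0 m≤lamk rows-nonempty , toℕ-opposite≡0 i k≡0 , c≡0))
    where
    c≡0 : c ≡ 0
    c≡0 = n≤0⇒n≡0 (+-cancelʳ-≤ m c 0 (subst (_≤ m) lamk≡c+m (bounded k)))

    m≤lamk : m ≤ lam k
    m≤lamk = ≤-reflexive (sym (trans lamk≡c+m (cong (_+ m) c≡0)))

    rows-nonempty : ∀ k' → 1 ≤ lam k'
    rows-nonempty k' = subst (_≤ lam k') (cong suc c≡0)
      (<conj⇒≤ antitone k' (subst (toℕ k' <_) (sym q≡n) (toℕ<n k')))
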